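{- For every integer $n\ge 1$ the following hold: $$\begin{bmatrix} 1& 0&-1 \\ -1&-1&0\\ 0&1&1 \end{bmatrix}^{n}=\begin{bmatrix} F_{n}&-F_{n-1}&-F_{n+1} \\ -F_{n-2}&F_{n-3}&F_{n-1}\\ -F_{n-1}&F_{n-2}&F_{n} \end{bmatrix},$$ $$\left(\frac{1}{2} \begin{bmatrix} 3& -1 &-4 \\ -1&-1&0\\ -1&1&2 \end{bmatrix}\right)^{n}=\frac{1}{2}\begin{bmatrix} P_{n+2}-P_{n+1}&-(P_{n+1}-P_{n})&-2P_{n+1} \\ -(P_{n}-P_{n-1})&P_{n-1}-P_{n-2}&2P_{n-1}\\ -(P_{n+1}-P_{n})&P_{n}-P_{n-1}&2P_{n} \end{bmatrix},$$ $$\begin{bmatrix} 2& 1&-1 \\ -2&-2&0\\ 0&1&1 \end{bmatrix}^{n}=\begin{bmatrix} 2J_{n}&-(J_{n+1}-2J_{n})&-J_{n+1} \\ -4J_{n-2}&2(J_{n-1}-2J_{n-2})&2J_{n-1}\\ -2J_{n-1}&J_{n}-2J_{n-1}&J_{n} \end{bmatrix}.$$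
   Context: $F_n$ are the Fibonacci numbers ($F_0=0$, $F_1=1$, $F_n=F_{n-1}+F_{n-2}$), $P_n$ the Pell numbers ($P_0=0$, $P_1=1$, $P_n=2P_{n-1}+P_{n-2}$), and $J_n$ the Jacobsthal numbers ($J_0=0$, $J_1=1$, $J_n=J_{n-1}+2J_{n-2}$). Each sequence is extended to negative indices by running its recurrence backwards (so $F_{ -1}=1$, $F_{ -2}=-1$, $P_{ -1}=1$, $J_{ -1}=1/2$). -}

module Defs where

open import Data.Nat using (ℕ; zero; suc)
open import Data.Fin using (Fin; zero; suc)
open import Data.Integer as ℤ using (ℤ; +_; -[1+_])
open import Data.Rational as ℚ using (ℚ; ½)

Mat : Set → Set
Mat A = Fin 3 → Fin 3 → A

mat3 : {A : Set} → A → A → A → A → A → A → A → A → A → Mat A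
mat3 a b c d e f g h i zero zero = a
mat3 a b c d e f g h i zero (suc zero) = b
mat3 a b c d e f g h i zero (suc (suc zero)) = c
mat3 a b c d e f g h i (suc zero) zero = d
mat3 a b c d e f g h i (suc zero) (suc zero) = e
mat3 a b c d e f g h i (suc zero) (suc (suc zero)) = f
mat3 a b c d e f g h i (suc (suc zero)) zero = g
mat3 a b c d e f g h i (suc (suc zero)) (suc zero) = h
mat3 a b c d e f g h i (suc (suc zero)) (suc (suc zero)) = i

matMul : {A : Set} → (A → A → A) → (A → A → A) → Mat A → Mat A → Mat A
matMul _+_ _*_ M N i j =
  ((M i zero * N zero j) + (M i (suc zero) * N (suc zero) j))
    + (M i (suc (suc zero)) * N (suc (suc zero)) j)

matId : {A : Set} → A → A → Mat A
matId z o = mat3 o z z z o z z z o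

matPow : {A : Set} → A → A → (A → A → A) → (A → A → A) → Mat A → ℕ → Mat A
matPow z o _+_ _*_ M zero = matId z o
matPow z o _+_ _*_ M (suc n) = matMul _+_ _*_ (matPow z o _+_ _*_ M n) M

ℤpow : Mat ℤ → ℕ → Mat ℤ
ℤpow = matPow (+ 0) (+ 1) ℤ._+_ ℤ._*_

ℚpow : Mat ℚ → ℕ → Mat ℚ
ℚpow = matPow ℚ.0ℚ ℚ.1ℚ ℚ._+_ ℚ._*_

ℚscale : ℚ → Mat ℚ → Mat ℚ
ℚscale c M i j = c ℚ.* M i j

ι : ℤ → ℚ
ι z = z ℚ./ 1

-- Fibonacci numbers on ℤ.  Non-negative indices: forward recurrence;
-- negative indices: recurrence run backwards, F_{m-2} = F_m - F_{m-1}.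

fibPos : ℕ → ℤ
fibPos zero = + 0
fibPos (suc zero) = + 1
fibPos (suc (suc n)) = fibPos (suc n) ℤ.+ fibPos n

-- fibNeg k = F_{-k}
fibNeg : ℕ → ℤ
fibNeg zero = + 0
fibNeg (suc zero) = + 1
fibNeg (suc (suc k)) = fibNeg k ℤ.- fibNeg (suc k)

F : ℤ → ℤ
F (+ n) = fibPos n
F -[1+ k ] = fibNeg (suc k)

-- Pell numbers on ℤ: P_m = 2 P_{m-1} + P_{m-2}; backwards
-- P_{m-2} = P_m - 2 P_{m-1}.

pellPos : ℕ → ℤ
pellPos zero = + 0
pellPos (suc zero) = + 1
pellPos (suc (suc n)) = (+ 2) ℤ.* pellPos (suc n) ℤ.+ pellPos n

-- pellNeg k = P_{-k}
pellNeg : ℕ → ℤ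
pellNeg zero = + 0
pellNeg (suc zero) = + 1
pellNeg (suc (suc k)) = pellNeg k ℤ.- (+ 2) ℤ.* pellNeg (suc k)

P : ℤ → ℤ
P (+ n) = pellPos n
P -[1+ k ] = pellNeg (suc k)

-- Jacobsthal numbers on ℤ with rational values: J_m = J_{m-1} + 2 J_{m-2};
-- backwards J_{m-2} = (J_m - J_{m-1}) / 2  (so J_{-1} = 1/2).

jacPos : ℕ → ℚ
jacPos zero = ℚ.0ℚ
jacPos (suc zero) = ℚ.1ℚ
jacPos (suc (suc n)) = jacPos (suc n) ℚ.+ ι (+ 2) ℚ.* jacPos n

-- jacNeg k = J_{-k}
jacNeg : ℕ → ℚ
jacNeg zero = ℚ.0ℚ
jacNeg (suc zero) = ½ ℚ.* (ℚ.1ℚ ℚ.- ℚ.0ℚ)  -- J_{-1} = (J_1 - J_0)/2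
jacNeg (suc (suc k)) = ½ ℚ.* (jacNeg k ℚ.- jacNeg (suc k))

J : ℤ → ℚ
J (+ n) = jacPos n
J -[1+ k ] = jacNeg (suc k)

module Submission where

-- Let s satisfy a second order
-- recurrence.  Every s (m + k) is a polynomial in s m, s (m + 1) (run the
-- recurrence on two variables), so the closed form of M^(m+1) is a matrix
-- T of polynomials read at (s m, s (m + 1)).  By induction on m
-- ('closedFormPowers', over any commutative ring) it suffices that
--   * M¹ = T at (s 0, s 1), a closed computation;
--   * T · M = T′ as polynomial matrices, where T′ is T with all offsets
--     raised by one (the ring solver's normal forms agree);
--   * T′ at (s m, s (m+1)) is T at (s (m+1), s (m+2)), by unfolding.
-- For Fibonacci (over ℤ), Pell and Jacobsthal (over ℚ) we take s to be
-- the family shifted so that its seeds are its values at negative indices,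
-- identify s with the family at every integer index of the statement, and
-- match the entries; for Pell this uses that ι : ℤ → ℚ is a ring
-- homomorphism.

open import Defs
open import Level using (0ℓ)
open import Data.Nat as ℕ using (ℕ; _≤_; zero; suc)
open import Data.Fin using (Fin; zero; suc)
open import Data.Vec using (Vec; []; _∷_)
open import Data.Product using (_×_; _,_)
open import Data.Integer as ℤ using (ℤ; +_; -_; _-_)
open import Data.Rational as ℚ using (ℚ; ½)
open import Data.Rational.Unnormalised as ℚᵘ using (mkℚᵘ; *≡*)
open import Algebra.Bundles using (CommutativeRing)
open import Relation.Binary.Definitions using (Decidable)
open import Relation.Binary.PropositionalEquality
  using (_≡_; refl; sym; trans; cong; cong₂; module ≡-Reasoning)
import Algebra.Solver.Ring.Simple as RingSolver
import Algebra.Solver.Ring.AlmostCommutativeRing as ACR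
import Data.Nat.Properties as ℕP
import Data.Integer.Properties as ℤP
import Data.Rational.Properties as ℚP
import Data.Rational.Unnormalised.Properties as ℚᵘP

entrywise : {P : Fin 3 → Fin 3 → Set} →
  P zero zero → P zero (suc zero) → P zero (suc (suc zero)) →
  P (suc zero) zero → P (suc zero) (suc zero) → P (suc zero) (suc (suc zero)) →
  P (suc (suc zero)) zero → P (suc (suc zero)) (suc zero) →
  P (suc (suc zero)) (suc (suc zero)) →
  ∀ i j → P i j
entrywise {P} p₀₀ p₀₁ p₀₂ p₁₀ p₁₁ p₁₂ p₂₀ p₂₁ p₂₂ = entry
  where
  entry : ∀ i j → P i j
  entry zero zero = p₀₀
  entry zero (suc zero) = p₀₁
  entry zero (suc (suc zero)) = p₀₂
  entry (suc zero) zero = p₁₀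
  entry (suc zero) (suc zero) = p₁₁
  entry (suc zero) (suc (suc zero)) = p₁₂
  entry (suc (suc zero)) zero = p₂₀
  entry (suc (suc zero)) (suc zero) = p₂₁
  entry (suc (suc zero)) (suc (suc zero)) = p₂₂

mat3-natural : {A B : Set} (f : A → B) {a b c d e g h k l : A} → ∀ i j →
  f (mat3 a b c d e g h k l i j) ≡ mat3 (f a) (f b) (f c) (f d) (f e) (f g) (f h) (f k) (f l) i j
mat3-natural f = entrywise refl refl refl refl refl refl refl refl refl

mat3-cong : {A : Set} {a b c d e g h k l a′ b′ c′ d′ e′ g′ h′ k′ l′ : A} →
  a ≡ a′ → b ≡ b′ → c ≡ c′ → d ≡ d′ → e ≡ e′ → g ≡ g′ → h ≡ h′ → k ≡ k′ → l ≡ l′ →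
  ∀ i j → mat3 a b c d e g h k l i j ≡ mat3 a′ b′ c′ d′ e′ g′ h′ k′ l′ i j
mat3-cong refl refl refl refl refl refl refl refl refl i j = refl

-- The sequence with initial terms x₀, x₁ continued by
-- s (k + 2) = next (s k) (s (k + 1)).  It is used both for concrete
-- values and symbolically, with polynomials as terms.
recurrence : {A : Set} → (A → A → A) → A → A → ℕ → A
recurrence next x₀ x₁ zero = x₀
recurrence next x₀ x₁ (suc zero) = x₁
recurrence next x₀ x₁ (suc (suc k)) =
  next (recurrence next x₀ x₁ k) (recurrence next x₀ x₁ (suc k))

module ClosedFormPowers (R : CommutativeRing 0ℓ 0ℓ)
                        (_≟_ : Decidable (CommutativeRing._≈_ R)) where

  open CommutativeRing R using (Carrier; _≈_; _+_; _*_; 0#; 1#; +-cong; *-congʳ)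
    renaming (trans to ≈-trans)
  open RingSolver (ACR.fromCommutativeRing R) _≟_ public

  pow : Mat Carrier → ℕ → Mat Carrier
  pow = matPow 0# 1# _+_ _*_

  matMul-congˡ : ∀ {X Y : Mat Carrier} (N : Mat Carrier) i →
    (∀ k → X i k ≈ Y i k) → ∀ j → matMul _+_ _*_ X N i j ≈ matMul _+_ _*_ Y N i j
  matMul-congˡ N i X≈Y j =
    +-cong (+-cong (*-congʳ (X≈Y zero)) (*-congʳ (X≈Y (suc zero))))
           (*-congʳ (X≈Y (suc (suc zero))))

  powersByInduction : (M : Mat Carrier) (C : ℕ → Mat Carrier) →
    (∀ i j → pow M 1 i j ≈ C 0 i j) →
    (∀ m i j → matMul _+_ _*_ (C m) M i j ≈ C (suc m) i j) →
    ∀ m i j → pow M (suc m) i j ≈ C m i j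
  powersByInduction M C base step zero i j = base i j
  powersByInduction M C base step (suc m) i j =
    ≈-trans (matMul-congˡ {pow M (suc m)} {C m} M i (powersByInduction M C base step m i) j) (step m i j)

  ⟦_⟧ᴹ : ∀ {n} → Mat (Polynomial n) → Vec Carrier n → Mat Carrier
  ⟦ T ⟧ᴹ ρ i j = ⟦ T i j ⟧ ρ

  constᴹ : ∀ {n} → Mat Carrier → Mat (Polynomial n)
  constᴹ M i j = con (M i j)

  closedFormPowers : ∀ {n} (M : Mat Carrier) (T T′ : Mat (Polynomial n))
    (ρ : ℕ → Vec Carrier n) →
    (∀ i j → pow M 1 i j ≈ ⟦ T ⟧ᴹ (ρ 0) i j) →
    (∀ ρ′ i j → ⟦ matMul _:+_ _:*_ T (constᴹ M) i j ⟧↓ ρ′ ≈ ⟦ T′ i j ⟧↓ ρ′) →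
    (∀ m i j → ⟦ T′ ⟧ᴹ (ρ m) i j ≈ ⟦ T ⟧ᴹ (ρ (suc m)) i j) →
    ∀ m i j → pow M (suc m) i j ≈ ⟦ T ⟧ᴹ (ρ m) i j
  closedFormPowers M T T′ ρ base sameNormalForm shift =
    powersByInduction M (λ m → ⟦ T ⟧ᴹ (ρ m)) base step
    where
    step : ∀ m i j → matMul _+_ _*_ (⟦ T ⟧ᴹ (ρ m)) M i j ≈ ⟦ T ⟧ᴹ (ρ (suc m)) i j
    step m i j = ≈-trans (prove (ρ m) (matMul _:+_ _:*_ T (constᴹ M) i j) (T′ i j)
                              (sameNormalForm (ρ m) i j))
                       (shift m i j)

-- The embedding ι : ℤ → ℚ is a ring homomorphism.  This is checked on
-- unnormalised rationals, where ι a is the fraction a/1.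
ι-toℚᵘ : ∀ a → ℚ.toℚᵘ (ι a) ℚᵘ.≃ mkℚᵘ a 0
ι-toℚᵘ a = ℚP.toℚᵘ-fromℚᵘ (mkℚᵘ a 0)

ι-+ : ∀ a b → ι (a ℤ.+ b) ≡ ι a ℚ.+ ι b
ι-+ a b = ℚP.toℚᵘ-injective (ℚᵘP.≃-trans (ι-toℚᵘ (a ℤ.+ b)) (ℚᵘP.≃-trans (*≡* fractions)
  (ℚᵘP.≃-sym (ℚᵘP.≃-trans (ℚP.toℚᵘ-homo-+ (ι a) (ι b)) (ℚᵘP.+-cong (ι-toℚᵘ a) (ι-toℚᵘ b))))))
  where
  fractions : (a ℤ.+ b) ℤ.* + 1 ≡ (a ℤ.* + 1 ℤ.+ b ℤ.* + 1) ℤ.* + 1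
  fractions = cong (ℤ._* + 1) (sym (cong₂ ℤ._+_ (ℤP.*-identityʳ a) (ℤP.*-identityʳ b)))

ι-* : ∀ a b → ι (a ℤ.* b) ≡ ι a ℚ.* ι b
ι-* a b = ℚP.toℚᵘ-injective (ℚᵘP.≃-trans (ι-toℚᵘ (a ℤ.* b))
  (ℚᵘP.≃-sym (ℚᵘP.≃-trans (ℚP.toℚᵘ-homo-* (ι a) (ι b)) (ℚᵘP.*-cong (ι-toℚᵘ a) (ι-toℚᵘ b)))))

ι-neg : ∀ a → ι (- a) ≡ ℚ.- ι a
ι-neg a = ℚP.toℚᵘ-injective (ℚᵘP.≃-trans (ι-toℚᵘ (- a))
  (ℚᵘP.≃-sym (ℚᵘP.≃-trans (ℚP.toℚᵘ-homo‿- (ι a)) (ℚᵘP.-‿cong (ι-toℚᵘ a)))))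

ι-- : ∀ a b → ι (a - b) ≡ ι a ℚ.- ι b
ι-- a b = trans (ι-+ a (- b)) (cong (ι a ℚ.+_) (ι-neg b))

module Fibonacci where
  open ClosedFormPowers ℤP.+-*-commutativeRing ℤP._≟_

  fib₂ : ℕ → ℤ
  fib₂ = recurrence (λ a b → b ℤ.+ a) (F (- + 2)) (F (- + 1))

  fib₂-spec : ∀ k → fib₂ k ≡ F (+ k - + 2)
  fib₂-spec 0 = refl
  fib₂-spec 1 = refl
  fib₂-spec 2 = refl
  fib₂-spec 3 = refl
  fib₂-spec (suc (suc k@(suc (suc _)))) = cong₂ ℤ._+_ (fib₂-spec (suc k)) (fib₂-spec k)

  -- The recurrence run on two variables: read at window m, σ k is
  -- fib₂ (m + k).
  σ : ℕ → Polynomial 2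
  σ = recurrence (λ a b → b :+ a) (var zero) (var (suc zero))

  window : ℕ → Vec ℤ 2
  window m = fib₂ m ∷ fib₂ (suc m) ∷ []

  M : Mat ℤ
  M = mat3 (+ 1) (+ 0) (- + 1) (- + 1) (- + 1) (+ 0) (+ 0) (+ 1) (+ 1)

  -- The closed form of M^(m+1) with offsets raised by d: read at window m,
  -- σ (k + 0) is F (n + k - 3) where n = m + 1.
  T : ℕ → Mat (Polynomial 2)
  T d = mat3 (σ (3 ℕ.+ d)) (:- σ (2 ℕ.+ d)) (:- σ (4 ℕ.+ d))
             (:- σ (1 ℕ.+ d)) (σ d) (σ (2 ℕ.+ d))
             (:- σ (2 ℕ.+ d)) (σ (1 ℕ.+ d)) (σ (3 ℕ.+ d))

  powers : ∀ m i j → ℤpow M (suc m) i j ≡ ⟦ T 0 ⟧ᴹ (window m) i j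
  powers = closedFormPowers M (T 0) (T 1) window
    (entrywise refl refl refl refl refl refl refl refl refl)
    (λ _ → entrywise refl refl refl refl refl refl refl refl refl)
    (λ _ → entrywise refl refl refl refl refl refl refl refl refl)

  F[n+1] : ∀ m → fib₂ (4 ℕ.+ m) ≡ F (+ suc m ℤ.+ + 1)
  F[n+1] m = trans (fib₂-spec (4 ℕ.+ m)) (cong (λ k → F (+ k)) (sym (ℕP.+-comm (suc m) 1)))

  F[n-3] : ∀ m → fib₂ m ≡ F (+ suc m - + 3)
  F[n-3] m = trans (fib₂-spec m) (cong F (sym (ℤP.[1+m]⊖[1+n]≡m⊖n m 2)))

  closedForm : ∀ m i j → ℤpow M (suc m) i j
      ≡ mat3 (F (+ suc m)) (- F (+ suc m - + 1)) (- F (+ suc m ℤ.+ + 1))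
             (- F (+ suc m - + 2)) (F (+ suc m - + 3)) (F (+ suc m - + 1))
             (- F (+ suc m - + 1)) (F (+ suc m - + 2)) (F (+ suc m)) i j
  closedForm m i j = trans (powers m i j) (trans (mat3-natural (λ p → ⟦ p ⟧ (window m)) i j)
    (mat3-cong (fib₂-spec (3 ℕ.+ m)) (cong -_ (fib₂-spec (2 ℕ.+ m))) (cong -_ (F[n+1] m))
               (cong -_ (fib₂-spec (1 ℕ.+ m))) (F[n-3] m) (fib₂-spec (2 ℕ.+ m))
               (cong -_ (fib₂-spec (2 ℕ.+ m))) (fib₂-spec (1 ℕ.+ m)) (fib₂-spec (3 ℕ.+ m)) i j))

module Pell where
  open ClosedFormPowers ℚP.+-*-commutativeRing ℚP._≟_

  pell₁ : ℕ → ℚ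
  pell₁ = recurrence (λ a b → ι (+ 2) ℚ.* b ℚ.+ a) (ι (P (- + 1))) (ι (P (+ 0)))

  pell₁-spec : ∀ k → pell₁ k ≡ ι (P (+ k - + 1))
  pell₁-spec 0 = refl
  pell₁-spec 1 = refl
  pell₁-spec 2 = refl
  pell₁-spec (suc (suc k@(suc k′))) = begin
    ι (+ 2) ℚ.* pell₁ (suc k) ℚ.+ pell₁ k
      ≡⟨ cong₂ (λ x y → ι (+ 2) ℚ.* x ℚ.+ y) (pell₁-spec (suc k)) (pell₁-spec k) ⟩
    ι (+ 2) ℚ.* ι (pellPos (suc k′)) ℚ.+ ι (pellPos k′)
      ≡⟨ cong (ℚ._+ ι (pellPos k′)) (ι-* (+ 2) (pellPos (suc k′))) ⟨
    ι (+ 2 ℤ.* pellPos (suc k′)) ℚ.+ ι (pellPos k′)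
      ≡⟨ ι-+ (+ 2 ℤ.* pellPos (suc k′)) (pellPos k′) ⟨
    ι (pellPos (suc (suc k′))) ∎
    where open ≡-Reasoning

  -- The recurrence run on two variables: read at window m, σ k is
  -- pell₁ (m + k).
  σ : ℕ → Polynomial 2
  σ = recurrence (λ a b → con (ι (+ 2)) :* b :+ a) (var zero) (var (suc zero))

  window : ℕ → Vec ℚ 2
  window m = pell₁ m ∷ pell₁ (suc m) ∷ []

  M : Mat ℚ
  M = ℚscale ½ (mat3 (ι (+ 3)) (ι (- + 1)) (ι (- + 4))
                     (ι (- + 1)) (ι (- + 1)) (ι (+ 0))
                     (ι (- + 1)) (ι (+ 1)) (ι (+ 2)))

  -- Twice the closed form of M^(m+1), with offsets raised by d: read at
  -- window m, σ (k + 0) is P (n + k - 2) where n = m + 1.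
  U : ℕ → Mat (Polynomial 2)
  U d = mat3 (σ (4 ℕ.+ d) :- σ (3 ℕ.+ d)) (:- (σ (3 ℕ.+ d) :- σ (2 ℕ.+ d)))
             (:- (con (ι (+ 2)) :* σ (3 ℕ.+ d)))
             (:- (σ (2 ℕ.+ d) :- σ (1 ℕ.+ d))) (σ (1 ℕ.+ d) :- σ d)
             (con (ι (+ 2)) :* σ (1 ℕ.+ d))
             (:- (σ (3 ℕ.+ d) :- σ (2 ℕ.+ d))) (σ (2 ℕ.+ d) :- σ (1 ℕ.+ d))
             (con (ι (+ 2)) :* σ (2 ℕ.+ d))

  T : ℕ → Mat (Polynomial 2)
  T d i j = con ½ :* U d i j

  powers : ∀ m i j → ℚpow M (suc m) i j ≡ ⟦ T 0 ⟧ᴹ (window m) i j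
  powers = closedFormPowers M (T 0) (T 1) window
    (entrywise refl refl refl refl refl refl refl refl refl)
    (λ _ → entrywise refl refl refl refl refl refl refl refl refl)
    (λ _ → entrywise refl refl refl refl refl refl refl refl refl)

  P[n+2] : ∀ m → pell₁ (4 ℕ.+ m) ≡ ι (P (+ suc m ℤ.+ + 2))
  P[n+2] m = trans (pell₁-spec (4 ℕ.+ m)) (cong (λ k → ι (P (+ k))) (sym (ℕP.+-comm (suc m) 2)))

  P[n+1] : ∀ m → pell₁ (3 ℕ.+ m) ≡ ι (P (+ suc m ℤ.+ + 1))
  P[n+1] m = trans (pell₁-spec (3 ℕ.+ m)) (cong (λ k → ι (P (+ k))) (sym (ℕP.+-comm (suc m) 1)))

  P[n-2] : ∀ m → pell₁ m ≡ ι (P (+ suc m - + 2))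
  P[n-2] m = trans (pell₁-spec m) (cong (λ z → ι (P z)) (sym (ℤP.[1+m]⊖[1+n]≡m⊖n m 1)))

  ι-diff : ∀ {x y} a b → x ≡ ι a → y ≡ ι b → x ℚ.- y ≡ ι (a - b)
  ι-diff a b x≡ y≡ = trans (cong₂ ℚ._-_ x≡ y≡) (sym (ι-- a b))

  ι-neg-diff : ∀ {x y} a b → x ≡ ι a → y ≡ ι b → ℚ.- (x ℚ.- y) ≡ ι (- (a - b))
  ι-neg-diff a b x≡ y≡ = trans (cong ℚ.-_ (ι-diff a b x≡ y≡)) (sym (ι-neg (a - b)))

  ι-double : ∀ {x} a → x ≡ ι a → ι (+ 2) ℚ.* x ≡ ι (+ 2 ℤ.* a)
  ι-double a x≡ = trans (cong (ι (+ 2) ℚ.*_) x≡) (sym (ι-* (+ 2) a))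

  closedForm : ∀ m i j → ℚpow M (suc m) i j
      ≡ ℚscale ½ (mat3 (ι (P (+ suc m ℤ.+ + 2) - P (+ suc m ℤ.+ + 1)))
                       (ι (- (P (+ suc m ℤ.+ + 1) - P (+ suc m))))
                       (ι (- (+ 2 ℤ.* P (+ suc m ℤ.+ + 1))))
                       (ι (- (P (+ suc m) - P (+ suc m - + 1))))
                       (ι (P (+ suc m - + 1) - P (+ suc m - + 2)))
                       (ι (+ 2 ℤ.* P (+ suc m - + 1)))
                       (ι (- (P (+ suc m ℤ.+ + 1) - P (+ suc m))))
                       (ι (P (+ suc m) - P (+ suc m - + 1)))
                       (ι (+ 2 ℤ.* P (+ suc m)))) i j
  closedForm m i j = trans (powers m i j) (cong (½ ℚ.*_)
    (trans (mat3-natural (λ p → ⟦ p ⟧ (window m)) i j) (mat3-cong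
      (ι-diff (P n+2) (P n+1) (P[n+2] m) (P[n+1] m))
      (ι-neg-diff (P n+1) (P n) (P[n+1] m) (pell₁-spec (2 ℕ.+ m)))
      (trans (cong ℚ.-_ (ι-double (P n+1) (P[n+1] m))) (sym (ι-neg (+ 2 ℤ.* P n+1))))
      (ι-neg-diff (P n) (P n-1) (pell₁-spec (2 ℕ.+ m)) (pell₁-spec (1 ℕ.+ m)))
      (ι-diff (P n-1) (P n-2) (pell₁-spec (1 ℕ.+ m)) (P[n-2] m))
      (ι-double (P n-1) (pell₁-spec (1 ℕ.+ m)))
      (ι-neg-diff (P n+1) (P n) (P[n+1] m) (pell₁-spec (2 ℕ.+ m)))
      (ι-diff (P n) (P n-1) (pell₁-spec (2 ℕ.+ m)) (pell₁-spec (1 ℕ.+ m)))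
      (ι-double (P n) (pell₁-spec (2 ℕ.+ m))) i j)))
    where
    n n+1 n+2 n-1 n-2 : ℤ
    n = + suc m
    n+1 = n ℤ.+ + 1
    n+2 = n ℤ.+ + 2
    n-1 = n - + 1
    n-2 = n - + 2

module Jacobsthal where
  open ClosedFormPowers ℚP.+-*-commutativeRing ℚP._≟_

  jac₁ : ℕ → ℚ
  jac₁ = recurrence (λ a b → b ℚ.+ ι (+ 2) ℚ.* a) (J (- + 1)) (J (+ 0))

  jac₁-spec : ∀ k → jac₁ k ≡ J (+ k - + 1)
  jac₁-spec 0 = refl
  jac₁-spec 1 = refl
  jac₁-spec 2 = refl
  jac₁-spec (suc (suc k@(suc _))) =
    cong₂ (λ x y → x ℚ.+ ι (+ 2) ℚ.* y) (jac₁-spec (suc k)) (jac₁-spec k)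

  -- The recurrence run on two variables: read at window m, σ k is
  -- jac₁ (m + k).
  σ : ℕ → Polynomial 2
  σ = recurrence (λ a b → b :+ con (ι (+ 2)) :* a) (var zero) (var (suc zero))

  window : ℕ → Vec ℚ 2
  window m = jac₁ m ∷ jac₁ (suc m) ∷ []

  M : Mat ℚ
  M = mat3 (ι (+ 2)) (ι (+ 1)) (ι (- + 1))
           (ι (- + 2)) (ι (- + 2)) (ι (+ 0))
           (ι (+ 0)) (ι (+ 1)) (ι (+ 1))

  two : ∀ {n} → Polynomial n
  two = con (ι (+ 2))

  -- The closed form of M^(m+1) with offsets raised by d: read at window m,
  -- σ (k + 0) is J (n + k - 2) where n = m + 1.
  T : ℕ → Mat (Polynomial 2)
  T d = mat3 (two :* σ (2 ℕ.+ d)) (:- (σ (3 ℕ.+ d) :- two :* σ (2 ℕ.+ d))) (:- σ (3 ℕ.+ d))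
             (:- (con (ι (+ 4)) :* σ d)) (two :* (σ (1 ℕ.+ d) :- two :* σ d))
             (two :* σ (1 ℕ.+ d))
             (:- (two :* σ (1 ℕ.+ d))) (σ (2 ℕ.+ d) :- two :* σ (1 ℕ.+ d)) (σ (2 ℕ.+ d))

  powers : ∀ m i j → ℚpow M (suc m) i j ≡ ⟦ T 0 ⟧ᴹ (window m) i j
  powers = closedFormPowers M (T 0) (T 1) window
    (entrywise refl refl refl refl refl refl refl refl refl)
    (λ _ → entrywise refl refl refl refl refl refl refl refl refl)
    (λ _ → entrywise refl refl refl refl refl refl refl refl refl)

  J[n+1] : ∀ m → jac₁ (3 ℕ.+ m) ≡ J (+ suc m ℤ.+ + 1)
  J[n+1] m = trans (jac₁-spec (3 ℕ.+ m)) (cong (λ k → J (+ k)) (sym (ℕP.+-comm (suc m) 1)))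

  J[n-2] : ∀ m → jac₁ m ≡ J (+ suc m - + 2)
  J[n-2] m = trans (jac₁-spec m) (cong J (sym (ℤP.[1+m]⊖[1+n]≡m⊖n m 1)))

  closedForm : ∀ m i j → ℚpow M (suc m) i j
      ≡ mat3 (ι (+ 2) ℚ.* J (+ suc m))
             (ℚ.- (J (+ suc m ℤ.+ + 1) ℚ.- ι (+ 2) ℚ.* J (+ suc m)))
             (ℚ.- J (+ suc m ℤ.+ + 1))
             (ℚ.- (ι (+ 4) ℚ.* J (+ suc m - + 2)))
             (ι (+ 2) ℚ.* (J (+ suc m - + 1) ℚ.- ι (+ 2) ℚ.* J (+ suc m - + 2)))
             (ι (+ 2) ℚ.* J (+ suc m - + 1))
             (ℚ.- (ι (+ 2) ℚ.* J (+ suc m - + 1)))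
             (J (+ suc m) ℚ.- ι (+ 2) ℚ.* J (+ suc m - + 1))
             (J (+ suc m)) i j
  closedForm m i j = trans (powers m i j) (trans (mat3-natural (λ p → ⟦ p ⟧ (window m)) i j)
    (mat3-cong (cong (ι (+ 2) ℚ.*_) Jₙ)
               (cong ℚ.-_ (cong₂ (λ x y → x ℚ.- ι (+ 2) ℚ.* y) (J[n+1] m) Jₙ))
               (cong ℚ.-_ (J[n+1] m))
               (cong (λ x → ℚ.- (ι (+ 4) ℚ.* x)) (J[n-2] m))
               (cong₂ (λ x y → ι (+ 2) ℚ.* (x ℚ.- ι (+ 2) ℚ.* y)) Jₙ₋₁ (J[n-2] m))
               (cong (ι (+ 2) ℚ.*_) Jₙ₋₁)
               (cong (λ x → ℚ.- (ι (+ 2) ℚ.* x)) Jₙ₋₁)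
               (cong₂ (λ x y → x ℚ.- ι (+ 2) ℚ.* y) Jₙ Jₙ₋₁)
               Jₙ i j))
    where
    Jₙ : jac₁ (2 ℕ.+ m) ≡ J (+ suc m)
    Jₙ = jac₁-spec (2 ℕ.+ m)
    Jₙ₋₁ : jac₁ (1 ℕ.+ m) ≡ J (+ suc m - + 1)
    Jₙ₋₁ = jac₁-spec (1 ℕ.+ m)

mainTheorem2 : (n : ℕ) → 1 ≤ n →
    ((i j : Fin 3) →
      ℤpow (mat3 (+ 1) (+ 0) (- + 1) (- + 1) (- + 1) (+ 0) (+ 0) (+ 1) (+ 1)) n i j
      ≡ mat3 (F (+ n)) (- F (+ n - + 1)) (- F (+ n ℤ.+ + 1))
             (- F (+ n - + 2)) (F (+ n - + 3)) (F (+ n - + 1))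
             (- F (+ n - + 1)) (F (+ n - + 2)) (F (+ n)) i j)
    × ((i j : Fin 3) →
      ℚpow (ℚscale ½ (mat3 (ι (+ 3)) (ι (- + 1)) (ι (- + 4))
                           (ι (- + 1)) (ι (- + 1)) (ι (+ 0))
                           (ι (- + 1)) (ι (+ 1)) (ι (+ 2)))) n i j
      ≡ ℚscale ½ (mat3 (ι (P (+ n ℤ.+ + 2) - P (+ n ℤ.+ + 1)))
                       (ι (- (P (+ n ℤ.+ + 1) - P (+ n))))
                       (ι (- (+ 2 ℤ.* P (+ n ℤ.+ + 1))))
                       (ι (- (P (+ n) - P (+ n - + 1))))
                       (ι (P (+ n - + 1) - P (+ n - + 2)))
                       (ι (+ 2 ℤ.* P (+ n - + 1)))
                       (ι (- (P (+ n ℤ.+ + 1) - P (+ n))))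
                       (ι (P (+ n) - P (+ n - + 1)))
                       (ι (+ 2 ℤ.* P (+ n)))) i j)
    × ((i j : Fin 3) →
      ℚpow (mat3 (ι (+ 2)) (ι (+ 1)) (ι (- + 1))
                 (ι (- + 2)) (ι (- + 2)) (ι (+ 0))
                 (ι (+ 0)) (ι (+ 1)) (ι (+ 1))) n i j
      ≡ mat3 (ι (+ 2) ℚ.* J (+ n))
             (ℚ.- (J (+ n ℤ.+ + 1) ℚ.- ι (+ 2) ℚ.* J (+ n)))
             (ℚ.- J (+ n ℤ.+ + 1))
             (ℚ.- (ι (+ 4) ℚ.* J (+ n - + 2)))
             (ι (+ 2) ℚ.* (J (+ n - + 1) ℚ.- ι (+ 2) ℚ.* J (+ n - + 2)))
             (ι (+ 2) ℚ.* J (+ n - + 1))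
             (ℚ.- (ι (+ 2) ℚ.* J (+ n - + 1)))
             (J (+ n) ℚ.- ι (+ 2) ℚ.* J (+ n - + 1))
             (J (+ n)) i j)
mainTheorem2 (suc m) _ = Fibonacci.closedForm m , Pell.closedForm m , Jacobsthal.closedForm m
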